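{- Let $G:\{0,1\}^n\to\{0,1\}^N$ be a Boolean circuit over a basis containing fan-in-2 $\oplus$ gates, and let $\mathsf{Ext}:\{0,1\}^N\times\{0,1\}^d\to\{0,1\}^m$ be linear, i.e., for every fixed $r$ the map $\mathsf{Ext}(\cdot,r):\mathbb{F}_2^N\to\mathbb{F}_2^m$ is $\mathbb{F}_2$-linear; for every $r$ fix a circuit for $\mathsf{Ext}(\cdot,r)$ using only fan-in-2 $\oplus$ gates, and let $C_r:\{0,1\}^n\to\{0,1\}^m$ be the circuit $C_r(s)=\mathsf{Ext}(G(s),r)$ obtained by composing. Then for every $y\in\{0,1\}^N$ and $r\in\{0,1\}^d$, there is a simple parity reduction from $\tau_y(G)$ to $\tau_z(C_r)$, where $z:=\mathsf{Ext}(y,r)$.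
   Context: For a circuit $C:\{0,1\}^n\to\{0,1\}^\ell$ and $b\in\{0,1\}^\ell$, $\tau_b(C)$ is the 3-CNF with variables $x\in\{0,1\}^n$ and one variable per internal (including output) gate of $C$; for each internal gate $g$ with operation $\circ_g$ and children $g_l,g_r$ it contains the clauses of the 3-CNF expressing $v_g=v_{g_l}\circ_g v_{g_r}$, and for each output gate $g_i$ ($i\in[\ell]$) the width-1 clause expressing $v_{g_i}=b_i$ (here $v_g$ is the variable of gate $g$, or $x_i$ for an input gate). It is unsatisfiable iff $b\notin\mathrm{Range}(C)$. For CNFs $F(x_1,\dots,x_n)$ and $H(y_1,\dots,y_{n'})$, a simple parity reduction from $F$ to $H$ is an $\mathbb{F}_2$-linear map $\mathsf{redu}:\{0,1\}^n\to\{0,1\}^{n'}$ (each output bit an XOR of a subset of input bits) such that for every clause $h$ of $H$, one of the following holds: $h\circ\mathsf{redu}\equiv\mathsf{True}$; $h\circ\mathsf{redu}$ equals some clause of $F$; or $h$ is a width-1 clause and $h\circ\mathsf{redu}$ is the XOR of a subset of (necessarily width-1) clauses of $F$. -}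

module Defs where

open import Data.Bool using (Bool; true; false; _xor_; _∧_; not; if_then_else_)
open import Data.Nat using (ℕ; zero; suc)
open import Data.Fin using (Fin; zero; suc; fromℕ; inject₁)
open import Data.Vec using (Vec; []; _∷_; _∷ʳ_; lookup; map)
open import Data.List as List using (List; []; _∷_; _++_; length)
open import Data.List.Membership.Propositional using (_∈_)
open import Data.Product using (Σ; _×_; _,_; proj₁; proj₂)
open import Data.Sum using (_⊎_)
open import Data.Unit using (⊤)
open import Relation.Binary.PropositionalEquality using (_≡_)

Op : Set
Op = Bool → Bool → Bool

record Gate (k : ℕ) : Set where
  constructor gate
  field
    op    : Op
    left  : Fin k
    right : Fin k

-- Nodes are Fin k: nodes 0..n-1 are the inputs,
-- node j ≥ n is the (j-n)-th gate; each new gate is the last node.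
data Gates (n : ℕ) : ℕ → Set where
  []  : Gates n n
  _▷_ : ∀ {k} → Gates n k → Gate k → Gates n (suc k)

record Circuit (n ℓ : ℕ) : Set where
  constructor circuit
  field
    nodes : ℕ
    gates : Gates n nodes
    out   : Vec (Fin nodes) ℓ
open Circuit public

vals : ∀ {n k} → Gates n k → Vec Bool n → Vec Bool k
vals [] x = x
vals (gs ▷ gate o l r) x =
  let v = vals gs x in v ∷ʳ o (lookup v l) (lookup v r)

eval : ∀ {n ℓ} → Circuit n ℓ → Vec Bool n → Vec Bool ℓ
eval C x = map (lookup (vals (gates C) x)) (out C)

AllOps : ∀ {n k} → (Op → Set) → Gates n k → Set
AllOps P [] = ⊤
AllOps P (gs ▷ g) = AllOps P gs × P (Gate.op g)

OverBasis : ∀ {n ℓ} → (Op → Set) → Circuit n ℓ → Set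
OverBasis B C = AllOps B (gates C)

XorOnly : ∀ {n ℓ} → Circuit n ℓ → Set
XorOnly C = AllOps (λ o → ∀ a b → o a b ≡ a xor b) (gates C)

-- appendGates gs ρ es : appends (a copy of) es to gs; ρ maps the nodes of
-- the partially built E (initially its inputs) to nodes of the result.
appendGates : ∀ {n k N k'} → Gates n k → Vec (Fin k) N → Gates N k' →
              Σ ℕ λ k'' → Gates n k'' × Vec (Fin k'') k'
appendGates gs ρ [] = _ , gs , ρ
appendGates gs ρ (es ▷ gate o l r) with appendGates gs ρ es
... | k'' , hs , σ =
  suc k'' , (hs ▷ gate o (lookup σ l) (lookup σ r)) , (map inject₁ σ ∷ʳ fromℕ k'')

compose : ∀ {n N m} → Circuit n N → Circuit N m → Circuit n m
compose G E with appendGates (gates G) (out G) (gates E)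
... | k'' , hs , σ = circuit k'' hs (map (lookup σ) (out E))

-- CNFs over variables Fin k.
-- A literal (v , p) is satisfied by x iff x v ≡ p.

Literal : ℕ → Set
Literal k = Fin k × Bool

Clause : ℕ → Set
Clause k = List (Literal k)

CNF : ℕ → Set
CNF k = List (Clause k)

Assignment : ℕ → Set
Assignment k = Fin k → Bool

litVal : ∀ {k} → Assignment k → Literal k → Bool
litVal x (v , p) = not (x v xor p)

clauseVal : ∀ {k} → Assignment k → Clause k → Bool
clauseVal x [] = false
clauseVal x (l ∷ c) = if litVal x l then true else clauseVal x c

weakenClause : ∀ {k} → Clause k → Clause (suc k)
weakenClause = List.map (λ { (v , p) → inject₁ v , p })

gateClauses : ∀ {k} → Gate k → CNF (suc k)
gateClauses {k} (gate o l r) =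
  List.map (λ { (a , b) → (inject₁ l , not a) ∷ (inject₁ r , not b) ∷ (fromℕ k , o a b) ∷ [] })
    ((false , false) ∷ (false , true) ∷ (true , false) ∷ (true , true) ∷ [])

gatesCNF : ∀ {n k} → Gates n k → CNF k
gatesCNF [] = []
gatesCNF (gs ▷ g) = List.map weakenClause (gatesCNF gs) ++ gateClauses g

outCNF : ∀ {k ℓ} → Vec (Fin k) ℓ → Vec Bool ℓ → CNF k
outCNF [] [] = []
outCNF (g ∷ gs) (b ∷ bs) = ((g , b) ∷ []) ∷ outCNF gs bs

τ : ∀ {n ℓ} → Vec Bool ℓ → (C : Circuit n ℓ) → CNF (nodes C)
τ b C = gatesCNF (gates C) ++ outCNF (out C) b

-- F_2-linear maps {0,1}^k → {0,1}^k' : output bit j is the XOR of the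
-- input bits i with M j i ≡ true.

parity : ∀ {k} → (Fin k → Bool) → Bool
parity {zero} f = false
parity {suc k} f = f zero xor parity (λ i → f (suc i))

LinMap : ℕ → ℕ → Set
LinMap k k' = Fin k' → Fin k → Bool

applyLin : ∀ {k k'} → LinMap k k' → Assignment k → Assignment k'
applyLin M x j = parity (λ i → M j i ∧ x i)

-- The "parity defect" of a width-1 clause (v , p), i.e. of the F_2 equation
-- x_v = p : it is x_v ⊕ p (the clause holds iff the defect is false).
-- (Only used on width-1 clauses.)
unitDefect : ∀ {k} → Clause k → Assignment k → Bool
unitDefect ((v , p) ∷ []) x = x v xor p
unitDefect _ x = false

ClauseCond : ∀ {k k'} → CNF k → LinMap k k' → Clause k' → Set
ClauseCond {k} F M h =
    (∀ (x : Assignment k) → clauseVal (applyLin M x) h ≡ true)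
  ⊎
    (Σ (Clause k) λ f → f ∈ F × (∀ (x : Assignment k) → clauseVal (applyLin M x) h ≡ clauseVal x f))
  ⊎
    (Σ (Literal _) λ l → h ≡ l ∷ [] ×
      Σ (Fin (length F) → Bool) λ sel →
        (∀ i → sel i ≡ true → Σ (Literal k) λ l' → List.lookup F i ≡ l' ∷ [])
      × (∀ (x : Assignment k) →
           unitDefect h (applyLin M x) ≡ parity (λ i → sel i ∧ unitDefect (List.lookup F i) x)))

SimpleParityReduction : ∀ {k k'} → CNF k → CNF k' → Set
SimpleParityReduction {k} {k'} F H =
  Σ (LinMap k k') λ M → ∀ (h : Clause k') → h ∈ H → ClauseCond F M h

{-# OPTIONS --safe #-}
module Submission where

-- The reduction keeps the variables of G and gives each copied ⊕-gate of the extractor circuit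
-- the XOR of the variables of G it depends on: it evaluates the linear part of C_r on an
-- arbitrary, not necessarily consistent, assignment x of the nodes of G. Gate clauses of G come
-- back verbatim and gate clauses of the extractor become tautologies. The output clause
-- v_{g_j} = z_j becomes Ext(x_out ⊕ y, r)_j = 0, where x_out is x on the output nodes of G;
-- expanding this linear form in coordinates writes it as an XOR of the output clauses
-- x_{out_i} = y_i of τ_y(G). Since the copied gates are ⊕, the evaluation is additive, hence
-- given by a matrix over F₂, which is the required linear map.

open import Defs
open import Algebra.Bundles using (CommutativeRing)
open import Data.Bool using (Bool; true; false; not; _∧_; _xor_; if_then_else_)
open import Data.Bool.Properties
  using (xor-same; xor-identityˡ; xor-identityʳ; ∧-identityʳ; ∧-zeroʳ; xor-∧-commutativeRing)
open import Algebra.Properties.CommutativeSemigroup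
  (CommutativeRing.+-commutativeSemigroup xor-∧-commutativeRing) using (interchange)
open import Data.Fin using (Fin; zero; suc; fromℕ; inject₁)
open import Data.List as List using ([]; _∷_; _++_; length)
open import Data.List.Membership.Propositional using (_∈_)
open import Data.List.Membership.Propositional.Properties using (∈-++⁻; ∈-++⁺ˡ; ∈-map⁻)
open import Data.List.Relation.Binary.Subset.Propositional using (_⊆_)
open import Data.List.Relation.Unary.Any using (here; there)
open import Data.Nat using (ℕ; zero; suc)
open import Data.Product using (Σ; _×_; _,_; proj₁; proj₂)
open import Data.Sum using (inj₁; inj₂)
open import Data.Vec using (Vec; []; _∷_; _∷ʳ_; lookup; map; replicate; tabulate; zipWith)
open import Data.Vec.Properties
  using (lookup-map; lookup-zipWith; lookup∘tabulate; map-∷ʳ; map-∘; map-cong; zipWith-identityˡ)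
open import Function using (_∘_)
open import Relation.Binary.PropositionalEquality
  using (_≡_; _≗_; refl; sym; trans; cong; cong₂; module ≡-Reasoning)

open ≡-Reasoning

parity-cong : ∀ {k} {f g : Fin k → Bool} → f ≗ g → parity f ≡ parity g
parity-cong {zero}  f≗g = refl
parity-cong {suc k} f≗g = cong₂ _xor_ (f≗g zero) (parity-cong (f≗g ∘ suc))

Additive : ∀ {N} → (Vec Bool N → Bool) → Set
Additive f = ∀ u w → f (zipWith _xor_ u w) ≡ f u xor f w

Linear : ∀ {N M} → (Vec Bool N → Vec Bool M) → Set
Linear f = ∀ u w → f (zipWith _xor_ u w) ≡ zipWith _xor_ (f u) (f w)

unitVec : ∀ {N} → Fin N → Vec Bool N
unitVec zero    = true ∷ replicate _ false
unitVec (suc i) = false ∷ unitVec i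

additive-zero : ∀ {N} (f : Vec Bool N → Bool) → Additive f → f (replicate N false) ≡ false
additive-zero f additive = begin
  f zeros                       ≡⟨ cong f (sym (zipWith-identityˡ xor-identityˡ zeros)) ⟩
  f (zipWith _xor_ zeros zeros) ≡⟨ additive zeros zeros ⟩
  f zeros xor f zeros           ≡⟨ xor-same (f zeros) ⟩
  false                         ∎
  where zeros = replicate _ false

additive-expansion : ∀ {N} (f : Vec Bool N → Bool) → Additive f →
                     ∀ w → f w ≡ parity (λ i → f (unitVec i) ∧ lookup w i)
additive-expansion {zero}  f additive [] = additive-zero f additive
additive-expansion {suc N} f additive (b ∷ w) = begin
  f (b ∷ w)                                         ≡⟨ cong f (sym split) ⟩
  f (zipWith _xor_ (b ∷ zeros) (false ∷ w))         ≡⟨ additive _ _ ⟩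
  f (b ∷ zeros) xor f (false ∷ w)                   ≡⟨ cong₂ _xor_ (headTerm b) (additive-expansion tailMap tailAdditive w) ⟩
  (f (unitVec zero) ∧ b) xor parity (λ i → f (unitVec (suc i)) ∧ lookup w i) ∎
  where
  zeros = replicate N false
  split : zipWith _xor_ (b ∷ zeros) (false ∷ w) ≡ b ∷ w
  split = cong₂ _∷_ (xor-identityʳ b) (zipWith-identityˡ xor-identityˡ w)
  headTerm : ∀ b → f (b ∷ zeros) ≡ f (unitVec zero) ∧ b
  headTerm true  = sym (∧-identityʳ _)
  headTerm false = trans (additive-zero f additive) (sym (∧-zeroʳ _))
  tailMap : Vec Bool N → Bool
  tailMap = f ∘ (false ∷_)
  tailAdditive : Additive tailMap
  tailAdditive u v = additive (false ∷ u) (false ∷ v)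

linear-lookup : ∀ {N M} {f : Vec Bool N → Vec Bool M} → Linear f → ∀ j → Additive (λ w → lookup (f w) j)
linear-lookup {f = f} linear j u w =
  trans (cong (λ v → lookup v j) (linear u w)) (lookup-zipWith _xor_ j (f u) (f w))

matrixOf : ∀ {k k'} → (Vec Bool k → Vec Bool k') → LinMap k k'
matrixOf f j i = lookup (f (unitVec i)) j

applyLin-matrixOf : ∀ {k k'} {f : Vec Bool k → Vec Bool k'} → Linear f →
                    ∀ x j → applyLin (matrixOf f) x j ≡ lookup (f (tabulate x)) j
applyLin-matrixOf {f = f} linear x j = sym (begin
  lookup (f (tabulate x)) j
    ≡⟨ additive-expansion (λ w → lookup (f w) j) (linear-lookup linear j) (tabulate x) ⟩
  parity (λ i → matrixOf f j i ∧ lookup (tabulate x) i)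
    ≡⟨ parity-cong (λ i → cong (matrixOf f j i ∧_) (lookup∘tabulate x i)) ⟩
  applyLin (matrixOf f) x j ∎)

module _ {A : Set} where

  lookup-∷ʳ-inject₁ : ∀ {k} (v : Vec A k) a i → lookup (v ∷ʳ a) (inject₁ i) ≡ lookup v i
  lookup-∷ʳ-inject₁ (b ∷ v) a zero    = refl
  lookup-∷ʳ-inject₁ (b ∷ v) a (suc i) = lookup-∷ʳ-inject₁ v a i

  lookup-∷ʳ-fromℕ : ∀ {k} (v : Vec A k) a → lookup (v ∷ʳ a) (fromℕ k) ≡ a
  lookup-∷ʳ-fromℕ []      a = refl
  lookup-∷ʳ-fromℕ (b ∷ v) a = lookup-∷ʳ-fromℕ v a

zipWith-∷ʳ : ∀ {A B C : Set} {k} (f : A → B → C) (u : Vec A k) (v : Vec B k) a b →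
             zipWith f (u ∷ʳ a) (v ∷ʳ b) ≡ zipWith f u v ∷ʳ f a b
zipWith-∷ʳ f []      []      a b = refl
zipWith-∷ʳ f (c ∷ u) (d ∷ v) a b = cong (f c d ∷_) (zipWith-∷ʳ f u v a b)

clauseVal-cong : ∀ {k} {X Y : Assignment k} → X ≗ Y → ∀ h → clauseVal X h ≡ clauseVal Y h
clauseVal-cong X≗Y []            = refl
clauseVal-cong X≗Y ((v , p) ∷ h) = cong₂ (λ b c → if not (b xor p) then true else c) (X≗Y v) (clauseVal-cong X≗Y h)

clauseVal-weaken : ∀ {k} (X : Assignment (suc k)) h →
                   clauseVal X (weakenClause h) ≡ clauseVal (X ∘ inject₁) h
clauseVal-weaken X []            = refl
clauseVal-weaken X ((v , p) ∷ h) = cong (if not (X (inject₁ v) xor p) then true else_) (clauseVal-weaken X h)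

gateClause-tail-true : ∀ (o : Op) a q b →
  (if not (q xor not b) then true else if not (o a q xor o a b) then true else false) ≡ true
gateClause-tail-true o a false true  = refl
gateClause-tail-true o a true  false = refl
gateClause-tail-true o a false false rewrite xor-same (o a false) = refl
gateClause-tail-true o a true  true  rewrite xor-same (o a true)  = refl

-- The gate clause for (a , b) under v_l = p, v_r = q, v_g = o p q; its first two literals
-- fail only when p = a and q = b, and then the last one holds.
gateClause-true : ∀ (o : Op) p q a b →
  (if not (p xor not a) then true else if not (q xor not b) then true else
   if not (o p q xor o a b) then true else false) ≡ true
gateClause-true o false q true  b = refl
gateClause-true o true  q false b = refl
gateClause-true o false q false b = gateClause-tail-true o false q b
gateClause-true o true  q true  b = gateClause-tail-true o true  q b

gateClauses-true : ∀ {k} (X : Assignment (suc k)) (g : Gate k) →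
  X (fromℕ k) ≡ Gate.op g (X (inject₁ (Gate.left g))) (X (inject₁ (Gate.right g))) →
  ∀ h → h ∈ gateClauses g → clauseVal X h ≡ true
gateClauses-true {k} X (gate o l r) consistent = clause
  where
  clauseFor : ∀ a b → clauseVal X ((inject₁ l , not a) ∷ (inject₁ r , not b) ∷ (fromℕ k , o a b) ∷ []) ≡ true
  clauseFor a b rewrite consistent = gateClause-true o (X (inject₁ l)) (X (inject₁ r)) a b
  clause : ∀ h → h ∈ gateClauses (gate o l r) → clauseVal X h ≡ true
  clause _ (here refl)                         = clauseFor false false
  clause _ (there (here refl))                 = clauseFor false true
  clause _ (there (there (here refl)))         = clauseFor true  false
  clause _ (there (there (there (here refl)))) = clauseFor true  true

XorOfUnitClauses : ∀ {k} → CNF k → (Assignment k → Bool) → Set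
XorOfUnitClauses {k} F D =
  Σ (Fin (length F) → Bool) λ sel →
      (∀ i → sel i ≡ true → Σ (Literal k) λ l → List.lookup F i ≡ l ∷ [])
    × (∀ x → D x ≡ parity (λ i → sel i ∧ unitDefect (List.lookup F i) x))

xorOfUnitClauses-cong : ∀ {k} {F : CNF k} {D D′ : Assignment k → Bool} →
                        (∀ x → D x ≡ D′ x) → XorOfUnitClauses F D′ → XorOfUnitClauses F D
xorOfUnitClauses-cong D≗D′ (sel , units , defect) = sel , units , λ x → trans (D≗D′ x) (defect x)

xorOfUnitClauses-++⁺ʳ : ∀ {k} (A : CNF k) {B D} → XorOfUnitClauses B D → XorOfUnitClauses (A ++ B) D
xorOfUnitClauses-++⁺ʳ []      xor-B = xor-B
xorOfUnitClauses-++⁺ʳ (a ∷ A) xor-B with xorOfUnitClauses-++⁺ʳ A xor-B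
... | sel , units , defect = (λ { zero → false ; (suc i) → sel i })
                           , (λ { zero () ; (suc i) → units i })
                           , defect

xorOfUnitClauses-outCNF : ∀ {k N} (ρ : Vec (Fin k) N) (y : Vec Bool N) (c : Fin N → Bool) →
  XorOfUnitClauses (outCNF ρ y) (λ x → parity (λ i → c i ∧ (x (lookup ρ i) xor lookup y i)))
xorOfUnitClauses-outCNF []      []      c = (λ ()) , (λ ()) , λ x → refl
xorOfUnitClauses-outCNF (g ∷ ρ) (b ∷ y) c with xorOfUnitClauses-outCNF ρ y (c ∘ suc)
... | sel , units , defect = (λ { zero → c zero ; (suc i) → sel i })
                           , (λ { zero _ → (g , b) , refl ; (suc i) → units i })
                           , λ x → cong (c zero ∧ (x g xor b) xor_) (defect x)

-- zipWith _xor_ (map x ρ) y is the vector of defects of the output clauses of τ_y.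
additive-xorOfOutputClauses : ∀ {k N} (ρ : Vec (Fin k) N) (y : Vec Bool N) (f : Vec Bool N → Bool) →
  Additive f → XorOfUnitClauses (outCNF ρ y) (λ x → f (zipWith _xor_ (map x ρ) y))
additive-xorOfOutputClauses ρ y f additive =
  xorOfUnitClauses-cong {F = outCNF ρ y} expand (xorOfUnitClauses-outCNF ρ y (f ∘ unitVec))
  where
  defectAt : ∀ x i → lookup (zipWith _xor_ (map x ρ) y) i ≡ x (lookup ρ i) xor lookup y i
  defectAt x i = trans (lookup-zipWith _xor_ i (map x ρ) y) (cong (_xor lookup y i) (lookup-map i x ρ))
  expand : ∀ x → f (zipWith _xor_ (map x ρ) y) ≡ parity (λ i → f (unitVec i) ∧ (x (lookup ρ i) xor lookup y i))
  expand x = trans (additive-expansion f additive _) (parity-cong (λ i → cong (f (unitVec i) ∧_) (defectAt x i)))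

∈-outCNF⁻ : ∀ {k N} (ρ : Vec (Fin k) N) (b : Vec Bool N) {h} → h ∈ outCNF ρ b →
            Σ (Fin N) λ j → h ≡ (lookup ρ j , lookup b j) ∷ []
∈-outCNF⁻ []      []      ()
∈-outCNF⁻ (g ∷ ρ) (c ∷ b) (here h≡)  = zero , h≡
∈-outCNF⁻ (g ∷ ρ) (c ∷ b) (there h∈) with ∈-outCNF⁻ ρ b h∈
... | j , h≡ = suc j , h≡

data TrueOrClauseOf {k k'} (F : CNF k) (φ : Assignment k → Assignment k') (h : Clause k') : Set where
  valid  : (∀ x → clauseVal (φ x) h ≡ true) → TrueOrClauseOf F φ h
  copyOf : ∀ f → f ∈ F → (∀ x → clauseVal (φ x) h ≡ clauseVal x f) → TrueOrClauseOf F φ h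

trueOrClauseOf-transport : ∀ {k k' k''} {F : CNF k} {φ : Assignment k → Assignment k'} {ψ : Assignment k → Assignment k''}
  {h h′} → (∀ x → clauseVal (ψ x) h′ ≡ clauseVal (φ x) h) → TrueOrClauseOf F φ h → TrueOrClauseOf F ψ h′
trueOrClauseOf-transport same (valid holds)      = valid (λ x → trans (same x) (holds x))
trueOrClauseOf-transport same (copyOf f f∈ same′) = copyOf f f∈ (λ x → trans (same x) (same′ x))

trueOrClauseOf⇒clauseCond : ∀ {k k'} {F F′ : CNF k} {M : LinMap k k'} {h} →
                            F ⊆ F′ → TrueOrClauseOf F (applyLin M) h → ClauseCond F′ M h
trueOrClauseOf⇒clauseCond F⊆F′ (valid holds)      = inj₁ holds
trueOrClauseOf⇒clauseCond F⊆F′ (copyOf f f∈ same) = inj₂ (inj₁ (f , F⊆F′ f∈ , same))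

IsXor : Op → Set
IsXor o = ∀ a b → o a b ≡ a xor b

snocGate : ∀ {k} → Vec Bool k → Gate k → Vec Bool (suc k)
snocGate v (gate o l r) = v ∷ʳ o (lookup v l) (lookup v r)

snocGate-consistent : ∀ {k} (v : Vec Bool k) (g : Gate k) → let X = lookup (snocGate v g) in
  X (fromℕ k) ≡ Gate.op g (X (inject₁ (Gate.left g))) (X (inject₁ (Gate.right g)))
snocGate-consistent v (gate o l r) =
  trans (lookup-∷ʳ-fromℕ v _) (sym (cong₂ o (lookup-∷ʳ-inject₁ v _ l) (lookup-∷ʳ-inject₁ v _ r)))

module Append {n k N} (gs : Gates n k) (ρ : Vec (Fin k) N) where

  size : ∀ {k'} → Gates N k' → ℕ
  size es = proj₁ (appendGates gs ρ es)

  appended : ∀ {k'} (es : Gates N k') → Gates n (size es)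
  appended es = proj₁ (proj₂ (appendGates gs ρ es))

  placement : ∀ {k'} (es : Gates N k') → Vec (Fin (size es)) k'
  placement es = proj₂ (proj₂ (appendGates gs ρ es))

  -- The nodes of gs keep the values w, which need not be consistent with gs.
  appendedVals : ∀ {k'} (es : Gates N k') → Vec Bool k → Vec Bool (size es)
  appendedVals []                w = w
  appendedVals (es ▷ gate o l r) w =
    snocGate (appendedVals es w) (gate o (lookup (placement es) l) (lookup (placement es) r))

  appendedVals-placement : ∀ {k'} (es : Gates N k') w →
                           map (lookup (appendedVals es w)) (placement es) ≡ vals es (map (lookup w) ρ)
  appendedVals-placement []                w = refl
  appendedVals-placement (es ▷ gate o l r) w = begin
    map (lookup (v ∷ʳ a)) (map inject₁ σ ∷ʳ fromℕ _)
      ≡⟨ map-∷ʳ _ _ (map inject₁ σ) ⟩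
    map (lookup (v ∷ʳ a)) (map inject₁ σ) ∷ʳ lookup (v ∷ʳ a) (fromℕ _)
      ≡⟨ cong₂ _∷ʳ_ (trans (sym (map-∘ _ inject₁ σ)) (map-cong (lookup-∷ʳ-inject₁ v a) σ)) (lookup-∷ʳ-fromℕ v a) ⟩
    map (lookup v) σ ∷ʳ a
      ≡⟨ cong (map (lookup v) σ ∷ʳ_) (sym (cong₂ o (lookup-map l (lookup v) σ) (lookup-map r (lookup v) σ))) ⟩
    snocGate (map (lookup v) σ) (gate o l r)
      ≡⟨ cong (λ u → snocGate u (gate o l r)) (appendedVals-placement es w) ⟩
    vals (es ▷ gate o l r) (map (lookup w) ρ) ∎
    where
    v = appendedVals es w
    σ = placement es
    a = o (lookup v (lookup σ l)) (lookup v (lookup σ r))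

  appendedVals-linear : ∀ {k'} (es : Gates N k') → AllOps IsXor es → Linear (appendedVals es)
  appendedVals-linear []                _              u w = refl
  appendedVals-linear (es ▷ gate o l r) (xorEs , xorO) u w = begin
    snocGate (appendedVals es (zipWith _xor_ u w)) g
      ≡⟨ cong (λ v → snocGate v g) (appendedVals-linear es xorEs u w) ⟩
    snocGate (zipWith _xor_ vu vw) g
      ≡⟨ cong (zipWith _xor_ vu vw ∷ʳ_) gate-additive ⟩
    zipWith _xor_ vu vw ∷ʳ (o (lookup vu σl) (lookup vu σr) xor o (lookup vw σl) (lookup vw σr))
      ≡⟨ sym (zipWith-∷ʳ _xor_ vu vw _ _) ⟩
    zipWith _xor_ (snocGate vu g) (snocGate vw g) ∎
    where
    vu = appendedVals es u
    vw = appendedVals es w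
    σl = lookup (placement es) l
    σr = lookup (placement es) r
    g = gate o σl σr
    gate-additive : o (lookup (zipWith _xor_ vu vw) σl) (lookup (zipWith _xor_ vu vw) σr)
                  ≡ o (lookup vu σl) (lookup vu σr) xor o (lookup vw σl) (lookup vw σr)
    gate-additive = begin
      o (lookup (zipWith _xor_ vu vw) σl) (lookup (zipWith _xor_ vu vw) σr)
        ≡⟨ cong₂ o (lookup-zipWith _xor_ σl vu vw) (lookup-zipWith _xor_ σr vu vw) ⟩
      o (lookup vu σl xor lookup vw σl) (lookup vu σr xor lookup vw σr)
        ≡⟨ xorO _ _ ⟩
      (lookup vu σl xor lookup vw σl) xor (lookup vu σr xor lookup vw σr)
        ≡⟨ interchange (lookup vu σl) (lookup vw σl) (lookup vu σr) (lookup vw σr) ⟩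
      (lookup vu σl xor lookup vu σr) xor (lookup vw σl xor lookup vw σr)
        ≡⟨ sym (cong₂ _xor_ (xorO _ _) (xorO _ _)) ⟩
      o (lookup vu σl) (lookup vu σr) xor o (lookup vw σl) (lookup vw σr) ∎

  appendedCNF-trueOrClauseOf : ∀ {k'} (es : Gates N k') h → h ∈ gatesCNF (appended es) →
    TrueOrClauseOf (gatesCNF gs) (λ x → lookup (appendedVals es (tabulate x))) h
  appendedCNF-trueOrClauseOf [] h h∈ = copyOf h h∈ (λ x → clauseVal-cong (lookup∘tabulate x) h)
  appendedCNF-trueOrClauseOf (es ▷ gate o l r) h h∈
    with ∈-++⁻ (List.map weakenClause (gatesCNF (appended es))) h∈
  ... | inj₁ h∈weakened with ∈-map⁻ weakenClause h∈weakened
  ...   | h₀ , h₀∈ , refl =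
    trueOrClauseOf-transport weakened (appendedCNF-trueOrClauseOf es h₀ h₀∈)
    where
    weakened : ∀ x → clauseVal (lookup (appendedVals (es ▷ gate o l r) (tabulate x))) (weakenClause h₀)
                   ≡ clauseVal (lookup (appendedVals es (tabulate x))) h₀
    weakened x = trans (clauseVal-weaken _ h₀) (clauseVal-cong (lookup-∷ʳ-inject₁ (appendedVals es (tabulate x)) _) h₀)
  appendedCNF-trueOrClauseOf (es ▷ gate o l r) h h∈ | inj₂ h∈gate =
    valid λ x → gateClauses-true _ g (snocGate-consistent (appendedVals es (tabulate x)) g) h h∈gate
    where
    g = gate o (lookup (placement es) l) (lookup (placement es) r)

reductionMatrix : ∀ {n N m} (G : Circuit n N) (E : Circuit N m) → LinMap (nodes G) (nodes (compose G E))
reductionMatrix G E = matrixOf (Append.appendedVals (gates G) (out G) (gates E))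

reduction-gateClauses : ∀ {n N m} (G : Circuit n N) (E : Circuit N m) → XorOnly E →
  ∀ h → h ∈ gatesCNF (gates (compose G E)) → TrueOrClauseOf (gatesCNF (gates G)) (applyLin (reductionMatrix G E)) h
reduction-gateClauses G E xorE h h∈ =
  trueOrClauseOf-transport (λ x → clauseVal-cong (applyLin-matrixOf (appendedVals-linear (gates E) xorE) x) h)
                           (appendedCNF-trueOrClauseOf (gates E) h h∈)
  where open Append (gates G) (out G)

reduction-outputs : ∀ {n N m} (G : Circuit n N) (E : Circuit N m) → XorOnly E →
  ∀ x → map (applyLin (reductionMatrix G E) x) (out (compose G E)) ≡ eval E (map x (out G))
reduction-outputs G E xorE x = begin
  map (applyLin (reductionMatrix G E) x) (map (lookup σ) (out E))
    ≡⟨ map-cong (applyLin-matrixOf (appendedVals-linear (gates E) xorE) x) _ ⟩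
  map (lookup V) (map (lookup σ) (out E))
    ≡⟨ sym (map-∘ _ _ (out E)) ⟩
  map (lookup V ∘ lookup σ) (out E)
    ≡⟨ map-cong (λ e → sym (lookup-map e (lookup V) σ)) (out E) ⟩
  map (lookup (map (lookup V) σ)) (out E)
    ≡⟨ cong (λ v → map (lookup v) (out E)) (appendedVals-placement (gates E) (tabulate x)) ⟩
  eval E (map (lookup (tabulate x)) (out G))
    ≡⟨ cong (eval E) (map-cong (lookup∘tabulate x) (out G)) ⟩
  eval E (map x (out G)) ∎
  where
  open Append (gates G) (out G)
  V = appendedVals (gates E) (tabulate x)
  σ = placement (gates E)

claim3p4 : ∀ {n N m d} (B : Op → Set) → B _xor_ →
           (G : Circuit n N) → OverBasis B G →
           (Ext : Vec Bool N → Vec Bool d → Vec Bool m) →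
           (∀ r x x′ → Ext (zipWith _xor_ x x′) r ≡ zipWith _xor_ (Ext x r) (Ext x′ r)) →
           (E : Vec Bool d → Circuit N m) → (∀ r → XorOnly (E r)) →
           (∀ r x → eval (E r) x ≡ Ext x r) →
           (y : Vec Bool N) (r : Vec Bool d) →
           SimpleParityReduction (τ y G) (τ (Ext y r) (compose G (E r)))
claim3p4 _ _ G _ Ext ext-linear E xorE evalE y r = reductionMatrix G (E r) , clauseCond
  where
  C = compose G (E r)
  X = applyLin (reductionMatrix G (E r))
  outputDefect : ∀ j x → X x (lookup (out C) j) xor lookup (Ext y r) j
                       ≡ lookup (Ext (zipWith _xor_ (map x (out G)) y) r) j
  outputDefect j x = begin
    X x (lookup (out C) j) xor lookup (Ext y r) j
      ≡⟨ cong (_xor lookup (Ext y r) j) (sym (lookup-map j (X x) (out C))) ⟩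
    lookup (map (X x) (out C)) j xor lookup (Ext y r) j
      ≡⟨ cong (λ v → lookup v j xor lookup (Ext y r) j) (trans (reduction-outputs G (E r) (xorE r) x) (evalE r _)) ⟩
    lookup (Ext (map x (out G)) r) j xor lookup (Ext y r) j
      ≡⟨ sym (linear-lookup (ext-linear r) j (map x (out G)) y) ⟩
    lookup (Ext (zipWith _xor_ (map x (out G)) y) r) j ∎
  clauseCond : ∀ h → h ∈ τ (Ext y r) C → ClauseCond (τ y G) (reductionMatrix G (E r)) h
  clauseCond h h∈ with ∈-++⁻ (gatesCNF (gates C)) h∈
  ... | inj₁ h∈gates = trueOrClauseOf⇒clauseCond ∈-++⁺ˡ (reduction-gateClauses G (E r) (xorE r) h h∈gates)
  ... | inj₂ h∈out with ∈-outCNF⁻ (out C) (Ext y r) h∈out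
  ...   | j , refl = inj₂ (inj₂ (_ , refl , xorOfUnitClauses-++⁺ʳ (gatesCNF (gates G))
          (xorOfUnitClauses-cong {F = outCNF (out G) y} (outputDefect j)
            (additive-xorOfOutputClauses (out G) y (λ w → lookup (Ext w r) j) (linear-lookup (ext-linear r) j)))))
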